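{- For every finite connected graph $G$, $\mathcal{L}(G)\le \operatorname{pw}(G)+1$.
   Context: Lions and contamination game. Let $G=(V,E)$ be a finite graph, $N(v)$ the set of neighbours of $v$. A lion strategy with $k\ge 1$ lions consists of initial positions $p_1(0),\dots,p_k(0)\in V$ and, for each $t\ge 1$, positions $p_i(t)\in\{p_i(t-1)\}\cup N(p_i(t-1))$. Put $L_t=\{p_i(t)\}_i$, $\pi_t=\{(p_i(t-1),p_i(t))\}_i$. Contaminated sets: $W_0=V\setminus L_0$, and for $t\ge1$, $W_t=(W_{t-1}\setminus L_t)\cup\{v\in V\setminus L_t:\exists w\in W_{t-1}\cap N(v)\text{ with }(v,w)\notin\pi_t,(w,v)\notin\pi_t\}$. The strategy clears $G$ if $W_T=\emptyset$ for some $T$; $\mathcal{L}(G)$ is the minimum number of lions of a clearing strategy. $\operatorname{pw}(G)$ denotes the pathwidth of $G$. -}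

module Defs where

open import Data.Nat using (ℕ; zero; suc; _<_; _≤_; _∸_; _⊔_)
open import Data.Fin using (Fin) renaming (_≤_ to _≤ᶠ_)
open import Data.Fin.Subset using (Subset; _∈_; ∣_∣)
open import Data.List using (foldr; map; allFin)
open import Data.Product using (_×_; ∃; ∃-syntax; Σ-syntax)
open import Data.Sum using (_⊎_)
open import Relation.Nullary using (¬_)
open import Relation.Binary.PropositionalEquality using (_≡_)

record Graph : Set₁ where
  field
    n     : ℕ
    Adj   : Fin n → Fin n → Set
    sym   : ∀ {u v} → Adj u v → Adj v u
    irref : ∀ {v} → ¬ Adj v v

open Graph public

data Reach (G : Graph) : Fin (n G) → Fin (n G) → Set where
  here : ∀ {u} → Reach G u u
  step : ∀ {u w v} → Adj G u w → Reach G w v → Reach G u v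

Connected : Graph → Set
Connected G = (0 < n G) × (∀ u v → Reach G u v)

record Strategy (G : Graph) (k : ℕ) : Set where
  field
    pos   : ℕ → Fin k → Fin (n G)
    moves : ∀ t i → (pos (suc t) i ≡ pos t i) ⊎ Adj G (pos t i) (pos (suc t) i)

open Strategy public

module _ {G : Graph} {k : ℕ} (S : Strategy G k) where

  Lions : ℕ → Fin (n G) → Set
  Lions t v = ∃[ i ] pos S t i ≡ v

  Moved : ℕ → Fin (n G) → Fin (n G) → Set
  Moved t a b = ∃[ i ] (pos S t i ≡ a × pos S (suc t) i ≡ b)

  Contaminated : ℕ → Fin (n G) → Set
  Contaminated zero v = ¬ Lions zero v
  Contaminated (suc t) v =
    ¬ Lions (suc t) v ×
    (Contaminated t v ⊎
      (∃[ w ] (Contaminated t w × Adj G v w × ¬ Moved t v w × ¬ Moved t w v)))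

  Clears : Set
  Clears = ∃[ T ] (∀ v → ¬ Contaminated T v)

LionNumber≤ : Graph → ℕ → Set
LionNumber≤ G m = ∃[ k ] (1 ≤ k × k ≤ m × Σ[ S ∈ Strategy G k ] Clears S)

record PathDecomposition (G : Graph) : Set where
  field
    len    : ℕ
    bag    : Fin len → Subset (n G)
    cover  : ∀ v → ∃[ i ] v ∈ bag i
    edges  : ∀ u v → Adj G u v → ∃[ i ] (u ∈ bag i × v ∈ bag i)
    interp : ∀ v {i j l} → i ≤ᶠ j → j ≤ᶠ l → v ∈ bag i → v ∈ bag l → v ∈ bag j

open PathDecomposition public

width : ∀ {G} → PathDecomposition G → ℕ
width D = foldr _⊔_ 0 (map (λ i → ∣ bag D i ∣) (allFin (len D))) ∸ 1

-- pw(G) ≤ w : there is a path decomposition of width ≤ w.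
-- Statement form of 𝓛(G) ≤ pw(G) + 1 : for every path decomposition D, 𝓛(G) ≤ width D + 1.

module Submission where

-- Colour the vertices with width + 1 colours so that every bag is rainbow, greedily along
-- the decomposition as for interval graphs: a vertex is coloured in the first bag containing
-- it, where fewer than width + 1 of its bag-mates are already coloured. In phase i lion c
-- stands on the vertex of colour c in bag i, and between phases every lion walks to its next
-- target; a vertex of B i ∩ B (i+1) keeps its lion during that walk, since its colour, hence
-- the target of its lion, is unchanged. By interpolation every edge leaving B 0 ∪ … ∪ B i
-- starts in that separator, so this region stays clear, and after the last phase the whole
-- graph is clear.

open import Defs
open import Data.Nat using (_+_)

open import Data.Empty using (⊥)
open import Data.Fin using (Fin; zero; suc; toℕ; fromℕ<)
open import Data.Fin.Properties using (any?; all?; toℕ<n; toℕ-fromℕ<; fromℕ<-toℕ; _≟_)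
open import Data.Fin.Subset
  using (Subset; inside; outside; ⁅_⁆; _∪_; _∩_; ∁; ∣_∣; _∈_; _∉_; _⊆_; _⊂_)
  renaming (⊥ to ∅)
open import Data.Fin.Subset.Properties
  using ( _∈?_; nonempty?; Empty-unique; ∣⊥∣≡0; ∣∁p∣≡n∸∣p∣; x∈∁p⇒x∉p; x∈⁅x⁆; x∈⁅y⁆⇒x≡y
        ; x∈p∪q⁻; ∣⁅x⁆∣≡1; q⊆p∪q; p⊆p∪q; x∈p∩q⁺; x∈p∩q⁻; p∩q⊆p; p⊂q⇒∣p∣<∣q∣; ∉⊥)
open import Data.List using (List; []; _∷_; allFin; foldr; map)
open import Data.List.Membership.Propositional using () renaming (_∈_ to _∈ₗ_)
open import Data.List.Membership.Propositional.Properties using (∈-allFin; ∈-map⁺)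
import Data.List.Relation.Unary.Any as ListAny
open import Data.Nat using (ℕ; zero; suc; _≤_; _<_; z≤n; s≤s; _⊔_; _∸_; _<?_; _≤?_)
open import Data.Nat.GeneralisedArithmetic using (fold; fold-+)
open import Data.Nat.Properties
  using ( ≤-refl; ≤-reflexive; ≤-trans; <⇒≤; ≤-<-trans; ≮⇒≥; ≰⇒>; n≤1+n; m≤n⇒m≤1+n
        ; m≤n⇒m<n∨m≡n; m<1+n⇒m<n∨m≡n; m<n⇒0<n∸m; m≤n+m∸n; m≤m⊔n; m≤n⊔m; +-suc; +-comm
        ; +-monoʳ-≤; module ≤-Reasoning)
open import Data.Product using (_×_; _,_; proj₁; proj₂; ∃-syntax; Σ-syntax)
open import Data.Sum using (_⊎_; inj₁; inj₂; map₁)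
open import Data.Unit using (⊤; tt)
open import Data.Vec using ([]; _∷_; here; there)
open import Data.Vec.Functional using (updateAt)
open import Data.Vec.Functional.Properties using (updateAt-updates; updateAt-minimal)
open import Function using (_∘_; id; const)
open import Relation.Binary.PropositionalEquality as ≡
  using (_≡_; _≢_; refl; trans; cong; subst; subst₂)
open import Relation.Nullary using (¬_; Dec; yes; no; contradiction)
open import Relation.Nullary.Decidable using (_×-dec_)

∣p∪q∣≤∣p∣+∣q∣ : ∀ {m} (p q : Subset m) → ∣ p ∪ q ∣ ≤ ∣ p ∣ + ∣ q ∣
∣p∪q∣≤∣p∣+∣q∣ [] [] = z≤n
∣p∪q∣≤∣p∣+∣q∣ (outside ∷ p) (outside ∷ q) = ∣p∪q∣≤∣p∣+∣q∣ p q
∣p∪q∣≤∣p∣+∣q∣ (inside ∷ p) (outside ∷ q) = s≤s (∣p∪q∣≤∣p∣+∣q∣ p q)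
∣p∪q∣≤∣p∣+∣q∣ (outside ∷ p) (inside ∷ q) =
  ≤-trans (s≤s (∣p∪q∣≤∣p∣+∣q∣ p q)) (≤-reflexive (≡.sym (+-suc ∣ p ∣ ∣ q ∣)))
∣p∪q∣≤∣p∣+∣q∣ (inside ∷ p) (inside ∷ q) =
  s≤s (≤-trans (∣p∪q∣≤∣p∣+∣q∣ p q) (+-monoʳ-≤ ∣ p ∣ (n≤1+n ∣ q ∣)))

x∈⁅y⁆∪p⁻ : ∀ {m} {x y : Fin m} (p : Subset m) → x ∈ ⁅ y ⁆ ∪ p → x ≡ y ⊎ x ∈ p
x∈⁅y⁆∪p⁻ p x∈ = map₁ (x∈⁅y⁆⇒x≡y _) (x∈p∪q⁻ _ p x∈)

∣p∣<n⇒∃∉ : ∀ {m} (p : Subset m) → ∣ p ∣ < m → ∃[ x ] x ∉ p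
∣p∣<n⇒∃∉ {m} p ∣p∣<m with nonempty? (∁ p)
... | yes (x , x∈∁p) = x , x∈∁p⇒x∉p x∈∁p
... | no ∁p-empty = contradiction (subst (0 <_) m∸∣p∣≡0 (m<n⇒0<n∸m ∣p∣<m)) λ ()
  where
  m∸∣p∣≡0 : m ∸ ∣ p ∣ ≡ 0
  m∸∣p∣≡0 = trans (≡.sym (∣∁p∣≡n∸∣p∣ p)) (trans (cong ∣_∣ (Empty-unique ∁p-empty)) (∣⊥∣≡0 m))

image : ∀ {m k} → (Fin m → Fin k) → Subset m → Subset k
image f [] = ∅
image f (outside ∷ p) = image (f ∘ suc) p
image f (inside ∷ p) = ⁅ f zero ⁆ ∪ image (f ∘ suc) p

x∈p⇒f[x]∈image : ∀ {m k} (f : Fin m → Fin k) {p x} → x ∈ p → f x ∈ image f p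
x∈p⇒f[x]∈image f {inside ∷ p} here = p⊆p∪q _ (x∈⁅x⁆ (f zero))
x∈p⇒f[x]∈image f {inside ∷ p} (there x∈p) = q⊆p∪q _ _ (x∈p⇒f[x]∈image (f ∘ suc) x∈p)
x∈p⇒f[x]∈image f {outside ∷ p} (there x∈p) = x∈p⇒f[x]∈image (f ∘ suc) x∈p

∣image∣≤∣p∣ : ∀ {m k} (f : Fin m → Fin k) (p : Subset m) → ∣ image f p ∣ ≤ ∣ p ∣
∣image∣≤∣p∣ {k = k} f [] = ≤-reflexive (∣⊥∣≡0 k)
∣image∣≤∣p∣ f (outside ∷ p) = ∣image∣≤∣p∣ (f ∘ suc) p
∣image∣≤∣p∣ f (inside ∷ p) = begin
  ∣ ⁅ f zero ⁆ ∪ image (f ∘ suc) p ∣    ≤⟨ ∣p∪q∣≤∣p∣+∣q∣ ⁅ f zero ⁆ _ ⟩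
  ∣ ⁅ f zero ⁆ ∣ + ∣ image (f ∘ suc) p ∣ ≡⟨ cong (_+ ∣ image (f ∘ suc) p ∣) (∣⁅x⁆∣≡1 (f zero)) ⟩
  suc ∣ image (f ∘ suc) p ∣             ≤⟨ s≤s (∣image∣≤∣p∣ (f ∘ suc) p) ⟩
  suc ∣ p ∣                             ∎
  where open ≤-Reasoning

maximum : List ℕ → ℕ
maximum = foldr _⊔_ 0

∈⇒≤maximum : ∀ {x xs} → x ∈ₗ xs → x ≤ maximum xs
∈⇒≤maximum (ListAny.here refl) = m≤m⊔n _ _
∈⇒≤maximum {xs = y ∷ _} (ListAny.there x∈xs) = ≤-trans (∈⇒≤maximum x∈xs) (m≤n⊔m y _)

≤maximum-allFin : ∀ {m} (f : Fin m → ℕ) i → f i ≤ maximum (map f (allFin m))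
≤maximum-allFin f i = ∈⇒≤maximum (∈-map⁺ f (∈-allFin i))

Interpolating : ∀ {N} → (ℕ → Subset N) → Set
Interpolating B = ∀ {v i j l} → i ≤ j → j ≤ l → v ∈ B i → v ∈ B l → v ∈ B j

module BagSequence {N : ℕ} (B : ℕ → Subset N) (interpolating : Interpolating B) where

  Seen : ℕ → Fin N → Set
  Seen i v = ∃[ j ] (j ≤ i × v ∈ B j)

  seen-suc⁺ : ∀ {i v} → Seen i v → Seen (suc i) v
  seen-suc⁺ (j , j≤i , v∈Bj) = j , m≤n⇒m≤1+n j≤i , v∈Bj

  seen-suc⁻ : ∀ {i v} → Seen (suc i) v → Seen i v ⊎ v ∈ B (suc i)
  seen-suc⁻ (j , j≤1+i , v∈Bj) with m≤n⇒m<n∨m≡n j≤1+i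
  ... | inj₁ (s≤s j≤i) = inj₁ (j , j≤i , v∈Bj)
  ... | inj₂ refl = inj₂ v∈Bj

  seen∧later⇒∈ : ∀ {i l v} → Seen i v → i ≤ l → v ∈ B l → v ∈ B i
  seen∧later⇒∈ (j , j≤i , v∈Bj) i≤l v∈Bl = interpolating j≤i i≤l v∈Bj v∈Bl

module Colouring {N : ℕ} (B : ℕ → Subset N) (interpolating : Interpolating B)
  {K : ℕ} (small : ∀ i → ∣ B i ∣ ≤ suc K) where

  open BagSequence B interpolating

  record PartialColouring (i : ℕ) : Set where
    field
      colour       : Fin N → Fin (suc K)
      done         : Subset N
      proper       : ∀ {j u w} → u ∈ done → w ∈ done → u ∈ B j → w ∈ B j →
                     colour u ≡ colour w → u ≡ w
      done-seen    : ∀ {u} → u ∈ done → Seen i u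
      earlier-done : ∀ {j u} → j < i → u ∈ B j → u ∈ done

  open PartialColouring

  module Extend {i} (s : PartialColouring i) {v} (v∈Bi : v ∈ B i) (v∉done : v ∉ done s) where

    used : Subset (suc K)
    used = image (colour s) (B i ∩ done s)

    few-used : ∣ used ∣ < suc K
    few-used = begin-strict
      ∣ used ∣         ≤⟨ ∣image∣≤∣p∣ (colour s) (B i ∩ done s) ⟩
      ∣ B i ∩ done s ∣ <⟨ p⊂q⇒∣p∣<∣q∣ B∩done⊂B ⟩
      ∣ B i ∣          ≤⟨ small i ⟩
      suc K            ∎
      where
      open ≤-Reasoning
      B∩done⊂B : B i ∩ done s ⊂ B i
      B∩done⊂B = p∩q⊆p (B i) (done s) , v , v∈Bi , v∉done ∘ proj₂ ∘ x∈p∩q⁻ (B i) (done s)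

    fresh : Fin (suc K)
    fresh = proj₁ (∣p∣<n⇒∃∉ used few-used)

    fresh∉used : fresh ∉ used
    fresh∉used = proj₂ (∣p∣<n⇒∃∉ used few-used)

    colour′ : Fin N → Fin (suc K)
    colour′ = updateAt (colour s) v (const fresh)

    colour′-old : ∀ {u} → u ∈ done s → colour′ u ≡ colour s u
    colour′-old u∈done = updateAt-minimal _ v (colour s) λ { refl → v∉done u∈done }

    -- v lies in no earlier bag, so a bag shared with u is at or after B i, hence u ∈ B i.
    fresh-differs : ∀ {j u} → u ∈ done s → v ∈ B j → u ∈ B j → colour′ v ≢ colour′ u
    fresh-differs {j} {u} u∈done v∈Bj u∈Bj same with j <? i
    ... | yes j<i = v∉done (earlier-done s j<i v∈Bj)
    ... | no j≮i = fresh∉used (subst (_∈ used) fresh≡colour-u colour-u-used)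
      where
      fresh≡colour-u : colour s u ≡ fresh
      fresh≡colour-u = begin
        colour s u ≡⟨ colour′-old u∈done ⟨
        colour′ u  ≡⟨ same ⟨
        colour′ v  ≡⟨ updateAt-updates v (colour s) ⟩
        fresh      ∎
        where open ≡.≡-Reasoning
      colour-u-used : colour s u ∈ used
      colour-u-used = x∈p⇒f[x]∈image (colour s)
        (x∈p∩q⁺ (seen∧later⇒∈ (done-seen s u∈done) (≮⇒≥ j≮i) u∈Bj , u∈done))

    extended : PartialColouring i
    extended = record
      { colour       = colour′
      ; done         = ⁅ v ⁆ ∪ done s
      ; proper       = proper′
      ; done-seen    = done-seen′
      ; earlier-done = λ j<i u∈Bj → q⊆p∪q _ _ (earlier-done s j<i u∈Bj)
      }
      where
      proper′ : ∀ {j u w} → u ∈ ⁅ v ⁆ ∪ done s → w ∈ ⁅ v ⁆ ∪ done s → u ∈ B j → w ∈ B j →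
                colour′ u ≡ colour′ w → u ≡ w
      proper′ u∈ w∈ u∈Bj w∈Bj same with x∈⁅y⁆∪p⁻ (done s) u∈ | x∈⁅y⁆∪p⁻ (done s) w∈
      ... | inj₁ refl | inj₁ refl = refl
      ... | inj₁ refl | inj₂ w∈done = contradiction same (fresh-differs w∈done u∈Bj w∈Bj)
      ... | inj₂ u∈done | inj₁ refl = contradiction (≡.sym same) (fresh-differs u∈done w∈Bj u∈Bj)
      ... | inj₂ u∈done | inj₂ w∈done = proper s u∈done w∈done u∈Bj w∈Bj
        (trans (≡.sym (colour′-old u∈done)) (trans same (colour′-old w∈done)))

      done-seen′ : ∀ {u} → u ∈ ⁅ v ⁆ ∪ done s → Seen i u
      done-seen′ u∈ with x∈⁅y⁆∪p⁻ (done s) u∈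
      ... | inj₁ refl = i , ≤-refl , v∈Bi
      ... | inj₂ u∈done = done-seen s u∈done

  include : ∀ {i} (s : PartialColouring i) v →
            Σ[ s′ ∈ PartialColouring i ] (done s ⊆ done s′ × (v ∈ B i → v ∈ done s′))
  include {i} s v with v ∈? done s | v ∈? B i
  ... | yes v∈done | _ = s , id , const v∈done
  ... | no v∉done | yes v∈Bi =
    Extend.extended s v∈Bi v∉done , q⊆p∪q _ _ , const (p⊆p∪q _ (x∈⁅x⁆ v))
  ... | no _ | no v∉Bi = s , id , λ v∈Bi → contradiction v∈Bi v∉Bi

  includeAll : ∀ {i} (s : PartialColouring i) (vs : List (Fin N)) →
               Σ[ s′ ∈ PartialColouring i ]
                 (done s ⊆ done s′ × (∀ {u} → u ∈ₗ vs → u ∈ B i → u ∈ done s′))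
  includeAll s [] = s , id , λ ()
  includeAll s (v ∷ vs) =
    let s₁ , s⊆s₁ , v-done = include s v
        s₂ , s₁⊆s₂ , vs-done = includeAll s₁ vs
    in s₂ , s₁⊆s₂ ∘ s⊆s₁ , λ { (ListAny.here refl) → s₁⊆s₂ ∘ v-done
                             ; (ListAny.there u∈vs) → vs-done u∈vs }

  nextBag : ∀ {i} → PartialColouring i → PartialColouring (suc i)
  nextBag {i} s with includeAll s (allFin N)
  ... | s′ , s⊆s′ , bag-done = record
    { colour       = colour s′
    ; done         = done s′
    ; proper       = proper s′
    ; done-seen    = seen-suc⁺ ∘ done-seen s′
    ; earlier-done = earlier-done′
    }
    where
    earlier-done′ : ∀ {j u} → j < suc i → u ∈ B j → u ∈ done s′
    earlier-done′ j<1+i u∈Bj with m<1+n⇒m<n∨m≡n j<1+i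
    ... | inj₁ j<i = s⊆s′ (earlier-done s j<i u∈Bj)
    ... | inj₂ refl = bag-done (∈-allFin _) u∈Bj

  colouring : ∀ i → PartialColouring i
  colouring zero = record
    { colour       = const zero
    ; done         = ∅
    ; proper       = λ u∈∅ → contradiction u∈∅ ∉⊥
    ; done-seen    = λ u∈∅ → contradiction u∈∅ ∉⊥
    ; earlier-done = λ ()
    }
  colouring (suc i) = nextBag (colouring i)

  module _ {L : ℕ} (below : ∀ {i v} → v ∈ B i → i < L) where

    κ : Fin N → Fin (suc K)
    κ = colour (colouring L)

    κ-injective : ∀ {j u w} → u ∈ B j → w ∈ B j → κ u ≡ κ w → u ≡ w
    κ-injective u∈Bj w∈Bj = proper (colouring L) (coloured u∈Bj) (coloured w∈Bj) u∈Bj w∈Bj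
      where
      coloured : ∀ {j u} → u ∈ B j → u ∈ done (colouring L)
      coloured u∈Bj = earlier-done (colouring L) (below u∈Bj) u∈Bj

module PathBags {G : Graph} (D : PathDecomposition G) where

  bagAt : ℕ → Subset (n G)
  bagAt i with i <? len D
  ... | yes i<len = bag D (fromℕ< i<len)
  ... | no _ = ∅

  ∈bagAt⁻ : ∀ {i v} → v ∈ bagAt i → Σ[ i<len ∈ i < len D ] v ∈ bag D (fromℕ< i<len)
  ∈bagAt⁻ {i} v∈ with i <? len D
  ... | yes i<len = i<len , v∈
  ... | no _ = contradiction v∈ ∉⊥

  ∈bagAt⁺ : ∀ {i v} (i<len : i < len D) → v ∈ bag D (fromℕ< i<len) → v ∈ bagAt i
  ∈bagAt⁺ {i} i<len v∈ with i <? len D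
  ... | yes _ = v∈
  ... | no i≮len = contradiction i<len i≮len

  ∈bag⇒∈bagAt : ∀ j {v} → v ∈ bag D j → v ∈ bagAt (toℕ j)
  ∈bag⇒∈bagAt j {v} v∈ =
    ∈bagAt⁺ (toℕ<n j) (subst (λ k → v ∈ bag D k) (≡.sym (fromℕ<-toℕ j (toℕ<n j))) v∈)

  ∈bagAt⇒<len : ∀ {i v} → v ∈ bagAt i → i < len D
  ∈bagAt⇒<len = proj₁ ∘ ∈bagAt⁻

  bagAt-interpolating : Interpolating bagAt
  bagAt-interpolating {v} {i} {j} {l} i≤j j≤l v∈i v∈l
    with ∈bagAt⁻ v∈i | ∈bagAt⁻ v∈l
  ... | i<len , v∈Di | l<len , v∈Dl = ∈bagAt⁺ j<len (interp D v i≤′j j≤′l v∈Di v∈Dl)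
    where
    j<len : j < len D
    j<len = ≤-<-trans j≤l l<len
    i≤′j : toℕ (fromℕ< i<len) ≤ toℕ (fromℕ< j<len)
    i≤′j = subst₂ _≤_ (≡.sym (toℕ-fromℕ< i<len)) (≡.sym (toℕ-fromℕ< j<len)) i≤j
    j≤′l : toℕ (fromℕ< j<len) ≤ toℕ (fromℕ< l<len)
    j≤′l = subst₂ _≤_ (≡.sym (toℕ-fromℕ< j<len)) (≡.sym (toℕ-fromℕ< l<len)) j≤l

  bagAt-edges : ∀ {u v} → Adj G u v → ∃[ j ] (u ∈ bagAt j × v ∈ bagAt j)
  bagAt-edges {u} {v} uv with edges D u v uv
  ... | j , u∈ , v∈ = toℕ j , ∈bag⇒∈bagAt j u∈ , ∈bag⇒∈bagAt j v∈

  bagAt-cover : ∀ v → ∃[ j ] (j < len D × v ∈ bagAt j)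
  bagAt-cover v with cover D v
  ... | j , v∈ = toℕ j , toℕ<n j , ∈bag⇒∈bagAt j v∈

  bagAt-small : ∀ i → ∣ bagAt i ∣ ≤ suc (width D)
  bagAt-small i with i <? len D
  ... | yes i<len = ≤-trans (≤maximum-allFin (λ j → ∣ bag D j ∣) (fromℕ< i<len)) (m≤n+m∸n _ 1)
  ... | no _ = ≤-trans (≤-reflexive (∣⊥∣≡0 (n G))) z≤n

module Walks (G : Graph) where

  next : ∀ {a b} → Reach G a b → Fin (n G)
  next {a} here = a
  next (step {w = w} _ _) = w

  rest : ∀ {a b} (r : Reach G a b) → Reach G (next r) b
  rest here = here
  rest (step _ r) = r

  length : ∀ {a b} → Reach G a b → ℕ
  length here = 0
  length (step _ r) = suc (length r)

  Trivial : ∀ {a b} → Reach G a b → Set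
  Trivial here = ⊤
  Trivial (step _ _) = ⊥

  trivial? : ∀ {a b} (r : Reach G a b) → Dec (Trivial r)
  trivial? here = yes tt
  trivial? (step _ _) = no id

  next-moves : ∀ {a b} (r : Reach G a b) → next r ≡ a ⊎ Adj G a (next r)
  next-moves here = inj₁ refl
  next-moves (step a~w _) = inj₂ a~w

  trivial⇒≡ : ∀ {a b} {r : Reach G a b} → Trivial r → a ≡ b
  trivial⇒≡ {r = here} _ = refl

  trivial⇒next≡ : ∀ {a b} {r : Reach G a b} → Trivial r → next r ≡ a
  trivial⇒next≡ {r = here} _ = refl

  trivial⇒rest-trivial : ∀ {a b} {r : Reach G a b} → Trivial r → Trivial (rest r)
  trivial⇒rest-trivial {r = here} _ = tt

  length≤0⇒trivial : ∀ {a b} (r : Reach G a b) → length r ≤ 0 → Trivial r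
  length≤0⇒trivial here _ = tt

  length-rest : ∀ {a b l} (r : Reach G a b) → length r ≤ suc l → length (rest r) ≤ l
  length-rest here _ = z≤n
  length-rest (step _ r) (s≤s len≤l) = len≤l

  module _ (connected : ∀ u v → Reach G u v) where

    walk : ∀ a b → Reach G a b
    walk a b with a ≟ b
    ... | yes refl = here
    ... | no _ = connected a b

    walk-trivial : ∀ {a b} → a ≡ b → Trivial (walk a b)
    walk-trivial {a} {b} a≡b with a ≟ b
    ... | yes refl = tt
    ... | no a≢b = contradiction a≡b a≢b

module _ {G : Graph} {k : ℕ} (S : Strategy G k) (Clear : ℕ → Fin (n G) → Set)
  (clear-start : ∀ {v} → Clear 0 v → Lions S 0 v)
  (clear-step : ∀ {t v} → Clear (suc t) v → ¬ Lions S (suc t) v →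
                Clear t v × (∀ {w} → Adj G v w → Clear t w))
  where

  clear⇒¬contaminated : ∀ t {v} → Clear t v → ¬ Contaminated S t v
  clear⇒¬contaminated zero clear no-lion = no-lion (clear-start clear)
  clear⇒¬contaminated (suc t) clear (no-lion , inj₁ was-contaminated) =
    clear⇒¬contaminated t (proj₁ (clear-step clear no-lion)) was-contaminated
  clear⇒¬contaminated (suc t) clear (no-lion , inj₂ (w , w-contaminated , v~w , _)) =
    clear⇒¬contaminated t (proj₂ (clear-step clear no-lion) v~w) w-contaminated

module LionSweep (G : Graph) (connected : ∀ u v → Reach G u v) (v₀ : Fin (n G))
  (B : ℕ → Subset (n G)) (interpolating : Interpolating B)
  (edge-bag : ∀ {u v} → Adj G u v → ∃[ j ] (u ∈ B j × v ∈ B j))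
  {K : ℕ} (κ : Fin (n G) → Fin K)
  (κ-injective : ∀ {j u w} → u ∈ B j → w ∈ B j → κ u ≡ κ w → u ≡ w)
  where

  open BagSequence B interpolating
  open Walks G

  seen-neighbour : ∀ {i v w} → Seen i v → (v ∈ B i → v ∉ B (suc i)) → Adj G v w → Seen i w
  seen-neighbour {i} (j , j≤i , v∈Bj) not-separating v~w with edge-bag v~w
  ... | j′ , v∈Bj′ , w∈Bj′ with j′ ≤? i
  ...   | yes j′≤i = j′ , j′≤i , w∈Bj′
  ...   | no j′≰i = contradiction (interpolating (m≤n⇒m≤1+n j≤i) i<j′ v∈Bj v∈Bj′)
                                  (not-separating (interpolating j≤i (<⇒≤ i<j′) v∈Bj v∈Bj′))
    where
    i<j′ : i < j′
    i<j′ = ≰⇒> j′≰i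

  -- v₀ is an arbitrary parking spot for lions whose colour is absent from bag i.
  target : ℕ → Fin K → Fin (n G)
  target i c with any? (λ v → v ∈? B i ×-dec κ v ≟ c)
  ... | yes (v , _) = v
  ... | no _ = v₀

  target-κ : ∀ {i v} → v ∈ B i → target i (κ v) ≡ v
  target-κ {i} {v} v∈Bi with any? (λ u → u ∈? B i ×-dec κ u ≟ κ v)
  ... | yes (u , u∈Bi , κu≡κv) = κ-injective u∈Bi v∈Bi κu≡κv
  ... | no none = contradiction (v , v∈Bi , refl) none

  record State : Set where
    field
      phase : ℕ
      at    : Fin K → Fin (n G)
      route : ∀ c → Reach G (at c) (target (suc phase) c)

  open State

  startPhase : ℕ → (Fin K → Fin (n G)) → State
  startPhase i p = record
    { phase = i ; at = p ; route = λ c → walk connected (p c) (target (suc i) c) }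

  walkOn : State → State
  walkOn s = record
    { phase = phase s ; at = λ c → next (route s c) ; route = λ c → rest (route s c) }

  Arrived : State → Set
  Arrived s = ∀ c → Trivial (route s c)

  advance : (s : State) → Dec (Arrived s) → State
  advance s (yes _) = startPhase (suc (phase s)) (at s)
  advance s (no _) = walkOn s

  arrived? : ∀ s → Dec (Arrived s)
  arrived? s = all? (λ c → trivial? (route s c))

  tick : State → State
  tick s = advance s (arrived? s)

  initial : State
  initial = startPhase 0 (target 0)

  run : ℕ → State
  run = fold initial tick

  advance-moves : ∀ s d c → at (advance s d) c ≡ at s c ⊎ Adj G (at s c) (at (advance s d) c)
  advance-moves s (yes _) c = inj₁ refl
  advance-moves s (no _) c = next-moves (route s c)

  strategy : Strategy G K
  strategy = record { pos = at ∘ run ; moves = λ t → advance-moves (run t) (arrived? (run t)) }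

  Occupied : State → Fin (n G) → Set
  Occupied s v = ∃[ c ] at s c ≡ v

  Guarded : State → Set
  Guarded s = ∀ {v} → v ∈ B (phase s) → v ∈ B (suc (phase s)) →
              at s (κ v) ≡ v × Trivial (route s (κ v))

  startPhase-guarded : ∀ i p → (∀ {v} → v ∈ B i → p (κ v) ≡ v) → Guarded (startPhase i p)
  startPhase-guarded i p occupied v∈Bi v∈Bi+1 =
    occupied v∈Bi , walk-trivial connected (trans (occupied v∈Bi) (≡.sym (target-κ v∈Bi+1)))

  walkOn-guarded : ∀ s → Guarded s → Guarded (walkOn s)
  walkOn-guarded s guarded v∈Bi v∈Bi+1 =
    let stays , idle = guarded v∈Bi v∈Bi+1
    in trans (trivial⇒next≡ idle) stays , trivial⇒rest-trivial idle

  arrived⇒occupied : ∀ s → Arrived s → ∀ {v} → v ∈ B (suc (phase s)) → at s (κ v) ≡ v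
  arrived⇒occupied s arrived v∈B = trans (trivial⇒≡ (arrived (κ _))) (target-κ v∈B)

  advance-guarded : ∀ s d → Guarded s → Guarded (advance s d)
  advance-guarded s (yes arrived) _ = startPhase-guarded _ (at s) (arrived⇒occupied s arrived)
  advance-guarded s (no _) guarded = walkOn-guarded s guarded

  run-guarded : ∀ t → Guarded (run t)
  run-guarded zero = startPhase-guarded 0 (target 0) target-κ
  run-guarded (suc t) = advance-guarded (run t) (arrived? (run t)) (run-guarded t)

  advance-shields : ∀ s d → Guarded s → ∀ {v} →
                    Seen (phase (advance s d)) v → ¬ Occupied (advance s d) v →
                    Seen (phase s) v × (∀ {w} → Adj G v w → Seen (phase s) w)
  advance-shields s (yes arrived) _ seen free with seen-suc⁻ seen
  ... | inj₂ v∈next = contradiction (κ _ , arrived⇒occupied s arrived v∈next) free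
  ... | inj₁ seen′ =
    seen′ , seen-neighbour seen′ λ _ v∈next → free (κ _ , arrived⇒occupied s arrived v∈next)
  advance-shields s (no _) guarded seen free =
    seen , seen-neighbour seen λ v∈Bi v∈next →
      free (κ _ , proj₁ (walkOn-guarded s guarded v∈Bi v∈next))

  run-clear : ∀ t {v} → Seen (phase (run t)) v → ¬ Contaminated strategy t v
  run-clear = clear⇒¬contaminated strategy (Seen ∘ phase ∘ run)
    (λ { (_ , z≤n , v∈B0) → κ _ , target-κ v∈B0 })
    (λ {t} → advance-shields (run t) (arrived? (run t)) (run-guarded t))

  phase-advances-within : ∀ l s → (∀ c → length (route s c) ≤ l) →
                          ∃[ m ] phase (fold s tick m) ≡ suc (phase s)
  phase-advances-after-advance : ∀ l s → (∀ c → length (route s c) ≤ l) → ∀ d →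
                                 ∃[ m ] phase (fold (advance s d) tick m) ≡ suc (phase s)

  phase-advances-within l s short =
    let m , advanced = phase-advances-after-advance l s short (arrived? s)
    in m + 1 , trans (cong phase (fold-+ s tick m)) advanced

  phase-advances-after-advance _ s _ (yes _) = 0 , refl
  phase-advances-after-advance zero s short (no not-arrived) =
    contradiction (λ c → length≤0⇒trivial (route s c) (short c)) not-arrived
  phase-advances-after-advance (suc l) s short (no _) =
    phase-advances-within l (walkOn s) (λ c → length-rest (route s c) (short c))

  reaches-phase : ∀ i → ∃[ t ] phase (run t) ≡ i
  reaches-phase zero = 0 , refl
  reaches-phase (suc i) =
    let t , at-i = reaches-phase i
        m , advanced = phase-advances-within _ (run t)
                         (≤maximum-allFin (λ c → length (route (run t) c)))
    in m + t , trans (cong phase (fold-+ initial tick m)) (trans advanced (cong suc at-i))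

  clears-seen : ∀ i → ∃[ T ] (∀ {v} → Seen i v → ¬ Contaminated strategy T v)
  clears-seen i with reaches-phase i
  ... | T , refl = T , run-clear T

theorem19 : (G : Graph) → Connected G →
    (D : PathDecomposition G) → LionNumber≤ G (width D + 1)
theorem19 G (0<n , connected) D =
  suc (width D) , s≤s z≤n , ≤-reflexive (+-comm 1 (width D)) , strategy , clears
  where
  open PathBags D
  open Colouring bagAt bagAt-interpolating bagAt-small using (κ; κ-injective)
  open LionSweep G connected (fromℕ< 0<n) bagAt bagAt-interpolating bagAt-edges
    (κ ∈bagAt⇒<len) (κ-injective ∈bagAt⇒<len)

  clears : Clears strategy
  clears =
    let T , clean = clears-seen (len D)
    in T , λ v → let j , j<len , v∈Bj = bagAt-cover v in clean (j , <⇒≤ j<len , v∈Bj)
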